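{- For every binary code $C \subseteq F^n$ containing $0^n$, $$\mathrm{Sym}(C) \leq \mathrm{Rot}(C) \leq \mathrm{Sym}(\mathrm{Ker}(C)).$$
   Context: Permutations in $S_n$ act on $F^n$ by permuting coordinates. $\mathrm{Sym}(C) = \{\pi \in S_n : \pi(C) = C\}$. $\mathrm{Rot}(C) = \{\pi \in S_n : \exists y \in C,\ y + \pi(C) = C\}$ (the group of rotations). $\mathrm{Ker}(C) = \{x \in C : x + C = C\}$ (the kernel, a linear subspace). $\le$ denotes "is a subgroup of". -}

module Defs where

open import Data.Nat using (ℕ)
open import Data.Bool using (Bool; false; _xor_)
open import Data.Fin using (Fin)
open import Data.Vec using (Vec; replicate; zipWith; tabulate; lookup)
open import Data.Fin.Permutation using (Permutation′; _⟨$⟩ˡ_)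
open import Data.Product using (∃; _×_)
open import Relation.Binary.PropositionalEquality using (_≡_)
open import Relation.Unary using (Pred; _≐_; _⊆_)
open import Level using (0ℓ)

-- The binary space F^n, F = GF(2) = Bool with xor as addition.
Word : ℕ → Set
Word n = Vec Bool n

Code : ℕ → Set₁
Code n = Pred (Word n) 0ℓ

0ⁿ : ∀ {n} → Word n
0ⁿ {n} = replicate n false

_⊕_ : ∀ {n} → Word n → Word n → Word n
_⊕_ = zipWith _xor_

-- Action of π ∈ S_n by permuting coordinates: (π·x)_{π(i)} = x_i.
_·_ : ∀ {n} → Permutation′ n → Word n → Word n
π · x = tabulate (λ i → lookup x (π ⟨$⟩ˡ i))

Image : ∀ {n} → (Word n → Word n) → Code n → Code n
Image f C z = ∃ λ x → C x × z ≡ f x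

permImage : ∀ {n} → Permutation′ n → Code n → Code n
permImage π C = Image (π ·_) C

Sym : ∀ {n} → Code n → Pred (Permutation′ n) 0ℓ
Sym C π = permImage π C ≐ C

Rot : ∀ {n} → Code n → Pred (Permutation′ n) 0ℓ
Rot C π = ∃ λ y → C y × (Image (y ⊕_) (permImage π C) ≐ C)

Ker : ∀ {n} → Code n → Code n
Ker C x = C x × (Image (x ⊕_) C ≐ C)

module Submission where

-- For a bijection with
-- inverse g, invariance is the same as f and g both preserving C.
--
-- * Sym(C) ≤ Rot(C): take y = 0ⁿ; translating by 0ⁿ is the identity.
-- * Rot(C) ≤ Sym(Ker(C)): if y + π(C) = C, the "rotation" ρ(a) = y + π·a and its
--   inverse ρ⁻¹(a) = π⁻¹·y + π⁻¹·a both preserve C.  For x ∈ Ker(C) and a ∈ C,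
--   linearity of π gives  π·x + a = ρ(x + ρ⁻¹(a)) ∈ C,  so π·x ∈ Ker(C); the same
--   argument with the roles of ρ and ρ⁻¹ exchanged gives π⁻¹·x ∈ Ker(C).

open import Defs
open import Data.Nat using (ℕ)
open import Data.Product using (_×_; _,_; proj₁; proj₂)
open import Relation.Unary using (_⊆_; _≐_)
open import Relation.Unary.Properties using (≐-sym; ≐-trans)
open import Data.Bool using (_xor_)
open import Data.Bool.Properties using (xor-assoc; xor-comm; xor-identityˡ; xor-identityʳ; xor-same)
open import Data.Vec using ([]; _∷_; lookup)
open import Data.Vec.Properties
  using (zipWith-assoc; zipWith-comm; zipWith-identityˡ; zipWith-identityʳ;
         lookup-zipWith; lookup∘tabulate; tabulate∘lookup; tabulate-cong)
open import Data.Fin.Permutation using (Permutation′; _⟨$⟩ˡ_; _⟨$⟩ʳ_; flip; inverseˡ; inverseʳ)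
open import Relation.Binary.PropositionalEquality using (_≡_; refl; sym; trans; cong; cong₂; subst; module ≡-Reasoning)
open ≡-Reasoning

private
  variable
    n : ℕ

⊕-assoc : (x y z : Word n) → (x ⊕ y) ⊕ z ≡ x ⊕ (y ⊕ z)
⊕-assoc = zipWith-assoc xor-assoc

⊕-comm : (x y : Word n) → x ⊕ y ≡ y ⊕ x
⊕-comm = zipWith-comm xor-comm

⊕-identityˡ : (x : Word n) → 0ⁿ ⊕ x ≡ x
⊕-identityˡ = zipWith-identityˡ xor-identityˡ

⊕-identityʳ : (x : Word n) → x ⊕ 0ⁿ ≡ x
⊕-identityʳ = zipWith-identityʳ xor-identityʳ

⊕-self : (x : Word n) → x ⊕ x ≡ 0ⁿ
⊕-self []      = refl
⊕-self (b ∷ x) = cong₂ _∷_ (xor-same b) (⊕-self x)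

⊕-cancelˡ : (x z : Word n) → x ⊕ (x ⊕ z) ≡ z
⊕-cancelˡ x z = begin
  x ⊕ (x ⊕ z)  ≡⟨ sym (⊕-assoc x x z) ⟩
  (x ⊕ x) ⊕ z  ≡⟨ cong (_⊕ z) (⊕-self x) ⟩
  0ⁿ ⊕ z       ≡⟨ ⊕-identityˡ z ⟩
  z            ∎

⊕-leftComm : (x y z : Word n) → x ⊕ (y ⊕ z) ≡ y ⊕ (x ⊕ z)
⊕-leftComm x y z = begin
  x ⊕ (y ⊕ z)  ≡⟨ sym (⊕-assoc x y z) ⟩
  (x ⊕ y) ⊕ z  ≡⟨ cong (_⊕ z) (⊕-comm x y) ⟩
  (y ⊕ x) ⊕ z  ≡⟨ ⊕-assoc y x z ⟩
  y ⊕ (x ⊕ z)  ∎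

word-ext : {a b : Word n} → (∀ i → lookup a i ≡ lookup b i) → a ≡ b
word-ext {a = a} {b} same =
  trans (sym (tabulate∘lookup a)) (trans (tabulate-cong same) (tabulate∘lookup b))

·-distrib-⊕ : (π : Permutation′ n) (a b : Word n) → π · (a ⊕ b) ≡ (π · a) ⊕ (π · b)
·-distrib-⊕ π a b = word-ext λ i → begin
  lookup (π · (a ⊕ b)) i                       ≡⟨ lookup∘tabulate _ i ⟩
  lookup (a ⊕ b) (π ⟨$⟩ˡ i)                     ≡⟨ lookup-zipWith _ (π ⟨$⟩ˡ i) a b ⟩
  lookup a (π ⟨$⟩ˡ i) xor lookup b (π ⟨$⟩ˡ i)   ≡⟨ sym (cong₂ _xor_ (lookup∘tabulate _ i) (lookup∘tabulate _ i)) ⟩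
  lookup (π · a) i xor lookup (π · b) i       ≡⟨ sym (lookup-zipWith _ i (π · a) (π · b)) ⟩
  lookup ((π · a) ⊕ (π · b)) i                 ∎

·-inverseˡ : (π : Permutation′ n) (a : Word n) → flip π · (π · a) ≡ a
·-inverseˡ π a = word-ext λ i →
  trans (lookup∘tabulate _ i) (trans (lookup∘tabulate _ (π ⟨$⟩ʳ i)) (cong (lookup a) (inverseˡ π)))

·-inverseʳ : (π : Permutation′ n) (a : Word n) → π · (flip π · a) ≡ a
·-inverseʳ π a = word-ext λ i →
  trans (lookup∘tabulate _ i) (trans (lookup∘tabulate _ (π ⟨$⟩ˡ i)) (cong (lookup a) (inverseʳ π)))

Preserves : Code n → (Word n → Word n) → Set
Preserves C f = ∀ {a} → C a → C (f a)

Invariant : Code n → (Word n → Word n) → Set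
Invariant C f = Image f C ≐ C

image-∘ : (f g : Word n → Word n) (C : Code n) → Image f (Image g C) ≐ Image (λ a → f (g a)) C
image-∘ f g C =
  (λ { (_ , (a , Ca , refl) , refl) → a , Ca , refl }) ,
  (λ { (a , Ca , refl) → g a , (a , Ca , refl) , refl })

image-id : (f : Word n → Word n) → (∀ a → f a ≡ a) → (C : Code n) → Image f C ≐ C
image-id f fixes C =
  (λ { (a , Ca , refl) → subst C (sym (fixes a)) Ca }) ,
  (λ {z} Cz → z , Cz , sym (fixes z))

module _ {C : Code n} {f : Word n → Word n} where

  invariant⇒preserves : Invariant C f → Preserves C f
  invariant⇒preserves (image⊆C , _) Ca = image⊆C (_ , Ca , refl)

  invariant⇒preserves-inverse : {g : Word n → Word n} → (∀ a → g (f a) ≡ a) → Invariant C f → Preserves C g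
  invariant⇒preserves-inverse g∘f (_ , C⊆image) Cz with C⊆image Cz
  ... | a , Ca , refl = subst C (sym (g∘f a)) Ca

  preserves⇒invariant : {g : Word n → Word n} → (∀ a → f (g a) ≡ a) → Preserves C f → Preserves C g → Invariant C f
  preserves⇒invariant {g} f∘g f-pres g-pres =
    (λ { (a , Ca , refl) → f-pres Ca }) ,
    (λ {z} Cz → g z , g-pres Cz , sym (f∘g z))

module _ {C : Code n} where

  kernel-translates : ∀ {x} → Ker C x → Preserves C (x ⊕_)
  kernel-translates (_ , translation-invariant) = invariant⇒preserves translation-invariant

  kernel-intro : C 0ⁿ → ∀ {x} → Preserves C (x ⊕_) → Ker C x
  kernel-intro C0 {x} translates =
    subst C (⊕-identityʳ x) (translates C0) ,
    preserves⇒invariant (⊕-cancelˡ x) translates translates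

rotation : Permutation′ n → Word n → Word n → Word n
rotation π y a = y ⊕ (π · a)

module _ (π : Permutation′ n) (y : Word n) where

  rotation-inverseʳ : ∀ a → rotation π y (rotation (flip π) (flip π · y) a) ≡ a
  rotation-inverseʳ a = begin
    y ⊕ (π · ((flip π · y) ⊕ (flip π · a)))          ≡⟨ cong (y ⊕_) (·-distrib-⊕ π (flip π · y) (flip π · a)) ⟩
    y ⊕ ((π · (flip π · y)) ⊕ (π · (flip π · a)))    ≡⟨ cong₂ (λ u v → y ⊕ (u ⊕ v)) (·-inverseʳ π y) (·-inverseʳ π a) ⟩
    y ⊕ (y ⊕ a)                                      ≡⟨ ⊕-cancelˡ y a ⟩
    a                                                ∎

  rotation-inverseˡ : ∀ a → rotation (flip π) (flip π · y) (rotation π y a) ≡ a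
  rotation-inverseˡ a = begin
    (flip π · y) ⊕ (flip π · (y ⊕ (π · a)))                  ≡⟨ cong ((flip π · y) ⊕_) (·-distrib-⊕ (flip π) y (π · a)) ⟩
    (flip π · y) ⊕ ((flip π · y) ⊕ (flip π · (π · a)))       ≡⟨ ⊕-cancelˡ (flip π · y) _ ⟩
    flip π · (π · a)                                         ≡⟨ ·-inverseˡ π a ⟩
    a                                                        ∎

rotation-preserves : (C : Code n) (π : Permutation′ n) (y : Word n) →
  Image (y ⊕_) (permImage π C) ≐ C →
  Preserves C (rotation π y) × Preserves C (rotation (flip π) (flip π · y))
rotation-preserves C π y y+πC≐C =
  invariant⇒preserves invariant , invariant⇒preserves-inverse (rotation-inverseˡ π y) invariant
  where
  invariant : Invariant C (rotation π y)
  invariant = ≐-trans (≐-sym (image-∘ (y ⊕_) (π ·_) C)) y+πC≐C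

-- Key step: if the rotation ρ by (σ, y) and some right inverse ρ⁻ of it preserve C,
-- then σ maps Ker(C) into itself, since σ·x ⊕ a = ρ(x ⊕ ρ⁻(a)).
kernel-transport : {C : Code n} → C 0ⁿ →
  (σ : Permutation′ n) (y : Word n) (ρ⁻ : Word n → Word n) →
  (∀ a → rotation σ y (ρ⁻ a) ≡ a) →
  Preserves C (rotation σ y) → Preserves C ρ⁻ → Preserves (Ker C) (σ ·_)
kernel-transport {C = C} C0 σ y ρ⁻ ρ∘ρ⁻ ρ-pres ρ⁻-pres {x} Kx =
  kernel-intro C0 (λ {a} Ca → subst C (σx⊕a≡ρ a) (ρ-pres (kernel-translates Kx (ρ⁻-pres Ca))))
  where
  σx⊕a≡ρ : ∀ a → rotation σ y (x ⊕ ρ⁻ a) ≡ (σ · x) ⊕ a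
  σx⊕a≡ρ a = begin
    y ⊕ (σ · (x ⊕ ρ⁻ a))            ≡⟨ cong (y ⊕_) (·-distrib-⊕ σ x (ρ⁻ a)) ⟩
    y ⊕ ((σ · x) ⊕ (σ · ρ⁻ a))      ≡⟨ ⊕-leftComm y (σ · x) _ ⟩
    (σ · x) ⊕ rotation σ y (ρ⁻ a)   ≡⟨ cong ((σ · x) ⊕_) (ρ∘ρ⁻ a) ⟩
    (σ · x) ⊕ a                     ∎

mainTheorem5 : (n : ℕ) (C : Code n) → C 0ⁿ →
    (Sym C ⊆ Rot C) × (Rot C ⊆ Sym (Ker C))
mainTheorem5 n C C0 = (λ {π} → sym⊆rot {π}) , (λ {π} → rot⊆symKer {π})
  where
  sym⊆rot : Sym C ⊆ Rot C
  sym⊆rot πC≐C = 0ⁿ , C0 , ≐-trans (image-id (0ⁿ ⊕_) ⊕-identityˡ _) πC≐C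

  rot⊆symKer : Rot C ⊆ Sym (Ker C)
  rot⊆symKer {π} (y , _ , y+πC≐C) =
    preserves⇒invariant (·-inverseʳ π)
      (kernel-transport C0 π y ρ⁻ (rotation-inverseʳ π y) ρ-pres ρ⁻-pres)
      (kernel-transport C0 (flip π) (flip π · y) (rotation π y) (rotation-inverseˡ π y) ρ⁻-pres ρ-pres)
    where
    ρ⁻ : Word n → Word n
    ρ⁻ = rotation (flip π) (flip π · y)
    ρ-pres : Preserves C (rotation π y)
    ρ-pres = proj₁ (rotation-preserves C π y y+πC≐C)
    ρ⁻-pres : Preserves C ρ⁻
    ρ⁻-pres = proj₂ (rotation-preserves C π y y+πC≐C)
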